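{- Let $n\ge1$ and $m=2n-1$. For every vector $v\in\mathbb{R}^m_{\ge0}$ there exists $\sigma\in Z_m$ such that $v'=(v'_1,\dots,v'_m)=\sigma(v)$ satisfies, for all $1\le k\le n-1$, $$\sum_{i=1}^k (v'_{2i-1}-v'_{2i})\ \ge\ 0\qquad\text{and}\qquad \sum_{i=1}^k (v'_{2n-(2i-1)}-v'_{2n-2i})\ \ge\ 0.$$ If furthermore all these inequalities are strict, then such a $\sigma$ is unique.
   Context: $Z_m$ is the cyclic group of order $m$ generated by $\rho$, acting on $\mathbb{R}^m$ by cyclically shifting coordinates, $\rho([x_1,\dots,x_m])=[x_m,x_1,\dots,x_{m-1}]$ (e.g. $\rho^2([0,1,2,3,4])=[3,4,0,1,2]$). -}

module Defs where

open import Level using (Level; suc; _⊔_)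
open import Data.Nat using (ℕ; zero; _∸_)
import Data.Nat as N
import Data.Fin
open import Data.Fin using (Fin; toℕ; fromℕ; inject₁; fromℕ<)
open import Data.Product using (Σ; ∃; _×_; _,_)
open import Relation.Binary.PropositionalEquality using (_≡_)
import Relation.Nullary
open import Relation.Nullary using (¬_)
open import Relation.Binary.Structures using (IsTotalOrder)
open import Algebra.Structures using (IsCommutativeRing)

-- The real numbers, axiomatised as a complete ordered field
-- (unique up to isomorphism), with propositional equality.
record RealField (c ℓ : Level) : Set (suc (c ⊔ ℓ)) where
  infix  4 _≤_ _<_
  infixl 6 _+_
  infixl 7 _*_
  field
    Carrier : Set c
    _+_ _*_ : Carrier → Carrier → Carrier
    -_      : Carrier → Carrier
    0# 1#   : Carrier
    isCommutativeRing : IsCommutativeRing _≡_ _+_ _*_ -_ 0# 1#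
    0≢1     : ¬ (0# ≡ 1#)
    inverse : ∀ x → ¬ (x ≡ 0#) → Σ Carrier (λ y → x * y ≡ 1#)
    _≤_     : Carrier → Carrier → Set ℓ
    isTotalOrder : IsTotalOrder _≡_ _≤_
    +-mono-≤ : ∀ {x y} z → x ≤ y → x + z ≤ y + z
    *-nonneg : ∀ {x y} → 0# ≤ x → 0# ≤ y → 0# ≤ x * y
    complete : (P : Carrier → Set ℓ) → Σ Carrier P →
               Σ Carrier (λ b → ∀ x → P x → x ≤ b) →
               Σ Carrier (λ s → (∀ x → P x → x ≤ s) ×
                                (∀ b → (∀ x → P x → x ≤ b) → s ≤ b))

  _<_ : Carrier → Carrier → Set (c ⊔ ℓ)
  x < y = (x ≤ y) × ¬ (x ≡ y)

  _-_ : Carrier → Carrier → Carrier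
  x - y = x + (- y)

predC : ∀ {m} → Fin m → Fin m
predC {N.suc m} Data.Fin.zero    = fromℕ m
predC {N.suc m} (Data.Fin.suc i) = inject₁ i

-- the generator ρ of Z_m: ρ([x₁,…,x_m]) = [x_m,x₁,…,x_{m-1}],
-- i.e. (ρ v)_i = v_{i-1} cyclically
ρ : ∀ {a} {A : Set a} {m} → (Fin m → A) → (Fin m → A)
ρ v i = v (predC i)

ρ^ : ∀ {a} {A : Set a} {m} → ℕ → (Fin m → A) → (Fin m → A)
ρ^ zero      v = v
ρ^ (N.suc j) v = ρ (ρ^ j v)

module _ {c ℓ} (R : RealField c ℓ) where
  open RealField R

  -- 1-based coordinate access: at v k = v_k for 1 ≤ k ≤ m (0 otherwise; never used)
  at : ∀ {m} → (Fin m → Carrier) → ℕ → Carrier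
  at {m} v zero = 0#
  at {m} v (N.suc k) with k N.<? m
  ... | Relation.Nullary.yes k<m = v (fromℕ< k<m)
  ... | Relation.Nullary.no  _   = 0#

  sumTo : ℕ → (ℕ → Carrier) → Carrier
  sumTo zero      f = 0#
  sumTo (N.suc k) f = sumTo k f + f (N.suc k)

  S₁ : ∀ {m} → (Fin m → Carrier) → ℕ → Carrier
  S₁ v k = sumTo k (λ i → at v (2 N.* i ∸ 1) - at v (2 N.* i))

  S₂ : ∀ {m} → ℕ → (Fin m → Carrier) → ℕ → Carrier
  S₂ n v k = sumTo k (λ i → at v (2 N.* n ∸ (2 N.* i ∸ 1)) - at v (2 N.* n ∸ 2 N.* i))

  Balanced : ∀ {m} → ℕ → (Fin m → Carrier) → Set ℓ
  Balanced n v = ∀ k → 1 N.≤ k → k N.≤ n ∸ 1 → (0# ≤ S₁ v k) × (0# ≤ S₂ n v k)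

  StrictlyBalanced : ∀ {m} → ℕ → (Fin m → Carrier) → Set (c ⊔ ℓ)
  StrictlyBalanced n v = ∀ k → 1 N.≤ k → k N.≤ n ∸ 1 → (0# < S₁ v k) × (0# < S₂ n v k)

  Nonneg : ∀ {m} → (Fin m → Carrier) → Set ℓ
  Nonneg v = ∀ i → 0# ≤ v i

module Submission where

-- Write m = 2N+1 (so n = N+1) and extend v to the m-periodic sequence
-- g x = v (x mod m).  The rotation ρ^σ v is read off g starting at the
-- position start σ = m − σ.  The central object is the potential
--     Φ x = g(x+1) + g(x+3) + … + g(x+2N−1),
-- the sum of N alternate entries after x.  As m is odd, g(x+2N+1) = g x and
--     Φ(x+2) + g(x+1) = Φ x + g x,
-- so both families of partial sums of the theorem telescope: with s = start σ,
--     Φ s + S₁(k) = Φ(s+2k)     and     Φ s + S₂(k) = Φ(s+2(N−k)+1).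
-- For 1 ≤ k ≤ N these offsets run through every j with 1 ≤ j ≤ 2N, hence
-- ρ^σ v is balanced iff Φ s ≤ Φ(s+j) for all those j, i.e. iff s minimises
-- the m-periodic function Φ, and strictly balanced iff s is a strict
-- minimiser.  A rotation minimising Φ therefore exists, and a strict
-- minimiser cannot coexist with another minimiser.

open import Defs
open import Level using (_⊔_)
open import Data.Nat using (ℕ; NonZero; zero; suc; _+_; _*_; _∸_; _≤_; _<_; _≤?_; _<?_; z≤n; s≤s)
open import Data.Nat.Properties
  using ( +-suc; +-comm; +-identityʳ; m≤m+n; <⇒≤; <⇒≱; ≰⇒>; ≮⇒≥; <-irrefl; ≤-trans; +-mono-≤; +-mono-<
        ; m<n⇒m<1+n; m∸n≤m; m<n⇒0<n∸m; m∸n+n≡m; m+[n∸m]≡n; m∸[m∸n]≡n; m+n∸m≡n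
        ; m≤n⇒∃[o]m+o≡n; <-cmp )
open import Data.Nat.DivMod using (_%_; m%n<n; [m+n]%n≡m%n; %-distribˡ-+; m<n⇒m%n≡m; n%n≡0)
open import Data.Nat.Tactic.RingSolver using (solve-∀)
open import Data.Fin using (Fin; toℕ; fromℕ<)
open import Data.Fin.Properties
  using (toℕ<n; toℕ-fromℕ; toℕ-inject₁; toℕ-fromℕ<; fromℕ<-cong; fromℕ<-toℕ; toℕ-injective)
import Data.Fin as Fin
open import Data.List using (allFin)
open import Data.List.Relation.Unary.Any as Any using ()
open import Data.List.Membership.Propositional.Properties using (∈-allFin)
import Data.List.Extrema as Extrema
open import Data.Product using (Σ; _×_; _,_; proj₁; proj₂; swap)
open import Data.Sum using (_⊎_; inj₁; inj₂)
open import Data.Empty using (⊥; ⊥-elim)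
open import Function using (_∘_)
open import Relation.Nullary using (yes; no)
open import Relation.Nullary.Negation using (contradiction)
open import Relation.Binary.Definitions using (Tri; tri<; tri≈; tri>)
open import Relation.Binary.Bundles using (TotalOrder)
open import Relation.Binary.Structures using (IsTotalOrder)
open import Algebra.Structures using (IsCommutativeRing)
open import Relation.Binary.PropositionalEquality
  using (_≡_; refl; sym; trans; cong; cong₂; subst; subst₂; module ≡-Reasoning)

≤-of-sum : ∀ {a b} c → a + c ≡ b → a ≤ b
≤-of-sum {a} c a+c≡b = subst (a ≤_) a+c≡b (m≤m+n a c)

parity : ∀ j → Σ ℕ (λ q → (j ≡ q + q) ⊎ (j ≡ suc (q + q)))
parity zero = 0 , inj₁ refl
parity (suc j) with parity j
... | q , inj₁ j≡2q  = q , inj₂ (cong suc j≡2q)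
... | q , inj₂ j≡2q+1 = suc q , inj₁ (trans (cong suc j≡2q+1) (cong suc (sym (+-suc q q))))

half-≤ : ∀ {q N} → q + q ≤ N + N → q ≤ N
half-≤ {q} {N} 2q≤2N with q ≤? N
... | yes q≤N = q≤N
... | no  q≰N = contradiction 2q≤2N (<⇒≱ (+-mono-< (≰⇒> q≰N) (≰⇒> q≰N)))

half-< : ∀ {q N} → suc (q + q) ≤ N + N → q < N
half-< {q} {N} 2q+1≤2N with q <? N
... | yes q<N = q<N
... | no  q≮N = ⊥-elim (<-irrefl refl (≤-trans 2q+1≤2N (+-mono-≤ (≮⇒≥ q≮N) (≮⇒≥ q≮N))))

every-offset : ∀ {p} {P : ℕ → Set p} N →
               (∀ k → 1 ≤ k → k ≤ N → P (k + k)) → (∀ d → d < N → P (suc (d + d))) →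
               ∀ j → 0 < j → j < suc (N + N) → P j
every-offset N even odd j 0<j (s≤s j≤2N) with parity j
... | zero  , inj₁ refl = contradiction 0<j λ ()
... | suc q , inj₁ refl = even (suc q) (s≤s z≤n) (half-≤ j≤2N)
... | q     , inj₂ refl = odd q (half-< j≤2N)

double-< : ∀ {d N} → d < N → suc (d + d) < N + N
double-< {d} {N} d<N = subst (_≤ N + N) (cong suc (+-suc d d)) (+-mono-≤ d<N d<N)

two-suc : ∀ k → 2 * suc k ≡ suc (suc (k + k))
two-suc = solve-∀

S₁-indices : ∀ k → (2 * suc k ∸ 1 ≡ suc (k + k)) × (2 * suc k ≡ suc (suc (k + k)))
S₁-indices k = cong (_∸ 1) (two-suc k) , two-suc k

S₂-indices : ∀ {N} k d → suc k + d ≡ N →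
             (2 * suc N ∸ (2 * suc k ∸ 1) ≡ suc (suc (suc (d + d)))) ×
             (2 * suc N ∸ 2 * suc k ≡ suc (suc (d + d)))
S₂-indices k d refl =
    trans (cong₂ _∸_ (split₁ k d) (proj₁ (S₁-indices k))) (m+n∸m≡n (suc (k + k)) _)
  , trans (cong₂ _∸_ (split₂ k d) (two-suc k)) (m+n∸m≡n (suc (suc (k + k))) _)
  where
  split₁ : ∀ k d → 2 * suc (suc k + d) ≡ suc (k + k) + suc (suc (suc (d + d)))
  split₁ = solve-∀
  split₂ : ∀ k d → 2 * suc (suc k + d) ≡ suc (suc (k + k)) + suc (suc (d + d))
  split₂ = solve-∀

-- For q < p < m each of the positions m − p, m − q is reached from the other
-- by a forward step j with 0 < j < m: directly from m − p to m − q, and from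
-- m − q to m − p after wrapping around once, i.e. landing at (m − p) + m.
gaps : ∀ {q p m} → q < p → p < m →
       Σ ℕ (λ j → 0 < j × j < m × (m ∸ p) + j ≡ m ∸ q) ×
       Σ ℕ (λ j → 0 < j × j < m × (m ∸ q) + j ≡ (m ∸ p) + m)
gaps {q} q<p p<m with m≤n⇒∃[o]m+o≡n q<p | m≤n⇒∃[o]m+o≡n p<m
... | d , refl | e , refl =
    (suc d , s≤s z≤n , ≤-of-sum (q + e) (sum₁ q d e) , trans (cong (_+ suc d) m∸p) (trans (sum₂ d e) (sym m∸q)))
  , (q + suc e , ≤-of-sum (q + e) (sum₃ q e) , ≤-of-sum d (sum₄ q d e) ,
     trans (cong (_+ (q + suc e)) m∸q) (trans (sum₅ q d e) (cong (_+ m) (sym m∸p))))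
  where
  p = suc q + d
  m = suc p + e
  m∸p : m ∸ p ≡ suc e
  m∸p = trans (cong (_∸ p) (sym (+-suc p e))) (m+n∸m≡n p (suc e))
  reassoc : ∀ q d e → suc (suc q + d) + e ≡ q + suc (suc (d + e))
  reassoc = solve-∀
  m∸q : m ∸ q ≡ suc (suc (d + e))
  m∸q = trans (cong (_∸ q) (reassoc q d e)) (m+n∸m≡n q _)
  sum₁ : ∀ q d e → suc (suc d) + (q + e) ≡ suc (suc q + d) + e
  sum₁ = solve-∀
  sum₂ : ∀ d e → suc e + suc d ≡ suc (suc (d + e))
  sum₂ = solve-∀
  sum₃ : ∀ q e → 1 + (q + e) ≡ q + suc e
  sum₃ = solve-∀
  sum₄ : ∀ q d e → suc (q + suc e) + d ≡ suc (suc q + d) + e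
  sum₄ = solve-∀
  sum₅ : ∀ q d e → suc (suc (d + e)) + (q + suc e) ≡ suc e + (suc (suc q + d) + e)
  sum₅ = solve-∀

+-cong-mod : ∀ {x y} o m .{{_ : NonZero m}} → x % m ≡ y % m → (x + o) % m ≡ (y + o) % m
+-cong-mod {x} {y} o m x≡y = begin
  (x + o) % m              ≡⟨ %-distribˡ-+ x o m ⟩
  (x % m + o % m) % m      ≡⟨ cong (λ r → (r + o % m) % m) x≡y ⟩
  (y % m + o % m) % m      ≡⟨ %-distribˡ-+ y o m ⟨
  (y + o) % m              ∎
  where open ≡-Reasoning

module Cyclic {a} {A : Set a} (M : ℕ) (v : Fin (suc M) → A) where

  m : ℕ
  m = suc M

  ext : ℕ → A
  ext x = v (fromℕ< (m%n<n x m))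

  ext-mod : ∀ x y → x % m ≡ y % m → ext x ≡ ext y
  ext-mod _ _ x≡y = cong v (fromℕ<-cong _ _ x≡y _ _)

  ext-toℕ : ∀ i → ext (toℕ i) ≡ v i
  ext-toℕ i = cong v (trans (fromℕ<-cong _ _ (m<n⇒m%n≡m (toℕ<n i)) _ (toℕ<n i)) (fromℕ<-toℕ i _))

  start : Fin m → ℕ
  start σ = m ∸ toℕ σ

  ρ^-ext : ∀ j q → j + q ≡ m → ∀ i → ρ^ j v i ≡ ext (toℕ i + q)
  ρ^-ext zero q refl i = sym (trans (ext-mod (toℕ i + m) (toℕ i) ([m+n]%n≡m%n (toℕ i) m)) (ext-toℕ i))
  ρ^-ext (suc j) q j+q≡m Fin.zero = trans (ρ^-ext j (suc q) (trans (+-suc j q) j+q≡m) _)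
    (ext-mod (toℕ (Fin.fromℕ M) + suc q) q
      (trans (cong (λ x → (x + suc q) % m) (toℕ-fromℕ M))
             (trans (cong (_% m) (M+q-comm M q)) ([m+n]%n≡m%n q m))))
    where
    M+q-comm : ∀ M q → M + suc q ≡ q + suc M
    M+q-comm = solve-∀
  ρ^-ext (suc j) q j+q≡m (Fin.suc i) = trans (ρ^-ext j (suc q) (trans (+-suc j q) j+q≡m) _)
    (cong ext (trans (cong (_+ suc q) (toℕ-inject₁ i)) (+-suc (toℕ i) q)))

  ρ^-start : ∀ σ i → ρ^ (toℕ σ) v i ≡ ext (start σ + toℕ i)
  ρ^-start σ i = trans (ρ^-ext (toℕ σ) (start σ) (m+[n∸m]≡n (<⇒≤ (toℕ<n σ))) i)
                       (cong ext (+-comm (toℕ i) (start σ)))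

  start-onto : ∀ y → Σ (Fin m) (λ σ → start σ % m ≡ y % m)
  start-onto y = hit (y % m) (m%n<n y m)
    where
    hit : ∀ r → r < m → Σ (Fin m) (λ σ → start σ % m ≡ r)
    hit zero    _   = Fin.zero , n%n≡0 m
    hit (suc r) r<m = fromℕ< m-r<m ,
      trans (cong (λ t → (m ∸ t) % m) (toℕ-fromℕ< m-r<m))
            (trans (cong (_% m) (m∸[m∸n]≡n (<⇒≤ r<m))) (m<n⇒m%n≡m r<m))
      where
      m-r<m : m ∸ suc r < m
      m-r<m = s≤s (m∸n≤m M r)

module OrderedField {c ℓ} (R : RealField c ℓ) where
  open RealField R renaming (_+_ to _⊕_; +-mono-≤ to ⊕-mono-≼; _-_ to _⊖_; _≤_ to _≼_; _<_ to _≺_)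
  open IsCommutativeRing isCommutativeRing using (-‿inverseʳ)
    renaming (+-assoc to ⊕-assoc; +-comm to ⊕-comm; +-identityˡ to ⊕-identityˡ; +-identityʳ to ⊕-identityʳ)
  open IsTotalOrder isTotalOrder using (antisym)
  open ≡-Reasoning

  ≼-totalOrder : TotalOrder c c ℓ
  ≼-totalOrder = record { isTotalOrder = isTotalOrder }

  add-sub : ∀ a x → (a ⊕ x) ⊖ a ≡ x
  add-sub a x = begin
    (a ⊕ x) ⊕ - a   ≡⟨ cong (_⊕ - a) (⊕-comm a x) ⟩
    (x ⊕ a) ⊕ - a   ≡⟨ ⊕-assoc x a (- a) ⟩
    x ⊕ (a ⊕ - a)   ≡⟨ cong (x ⊕_) (-‿inverseʳ a) ⟩
    x ⊕ 0#          ≡⟨ ⊕-identityʳ x ⟩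
    x               ∎

  solve-for : ∀ {a b c d} → a ⊕ b ≡ c ⊕ d → c ⊕ (d ⊖ b) ≡ a
  solve-for {a} {b} {c} {d} a+b≡c+d = begin
    c ⊕ (d ⊕ - b)   ≡⟨ ⊕-assoc c d (- b) ⟨
    (c ⊕ d) ⊕ - b   ≡⟨ cong (_⊕ - b) a+b≡c+d ⟨
    (a ⊕ b) ⊕ - b   ≡⟨ cong (_⊖ b) (⊕-comm a b) ⟩
    (b ⊕ a) ⊖ b     ≡⟨ add-sub b a ⟩
    a               ∎

  ≼-+-nonneg : ∀ a {x} → 0# ≼ x → a ≼ a ⊕ x
  ≼-+-nonneg a {x} 0≼x = subst₂ _≼_ (⊕-identityˡ a) (⊕-comm x a) (⊕-mono-≼ a 0≼x)

  ≺-+-pos : ∀ a {x} → 0# ≺ x → a ≺ a ⊕ x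
  ≺-+-pos a {x} (0≼x , 0≢x) = ≼-+-nonneg a 0≼x , λ a≡a+x →
    0≢x (sym (trans (sym (add-sub a x)) (trans (cong (_⊖ a) (sym a≡a+x)) (-‿inverseʳ a))))

  ≼-+-nonneg⁻¹ : ∀ a {x} → a ≼ a ⊕ x → 0# ≼ x
  ≼-+-nonneg⁻¹ a {x} a≼a+x = subst₂ _≼_ (-‿inverseʳ a) (add-sub a x) (⊕-mono-≼ (- a) a≼a+x)

  ≺-≼-asym : ∀ {x y} → x ≺ y → y ≼ x → ⊥
  ≺-≼-asym (x≼y , x≢y) y≼x = x≢y (antisym x≼y y≼x)

  sumTo-cong : ∀ k {f h : ℕ → Carrier} → (∀ i → f (suc i) ≡ h (suc i)) → sumTo R k f ≡ sumTo R k h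
  sumTo-cong zero    f≗h = refl
  sumTo-cong (suc k) f≗h = cong₂ _⊕_ (sumTo-cong k f≗h) (f≗h k)

  sumTo-shift : ∀ k (f : ℕ → Carrier) → sumTo R k (f ∘ suc) ⊕ f 1 ≡ sumTo R k f ⊕ f (suc k)
  sumTo-shift zero    f = refl
  sumTo-shift (suc k) f = begin
    (sumTo R k (f ∘ suc) ⊕ f (suc (suc k))) ⊕ f 1   ≡⟨ swap-last _ _ _ ⟩
    (sumTo R k (f ∘ suc) ⊕ f 1) ⊕ f (suc (suc k))   ≡⟨ cong (_⊕ f (suc (suc k))) (sumTo-shift k f) ⟩
    (sumTo R k f ⊕ f (suc k)) ⊕ f (suc (suc k))     ∎
    where
    swap-last : ∀ x y z → (x ⊕ y) ⊕ z ≡ (x ⊕ z) ⊕ y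
    swap-last x y z = begin
      (x ⊕ y) ⊕ z   ≡⟨ ⊕-assoc x y z ⟩
      x ⊕ (y ⊕ z)   ≡⟨ cong (x ⊕_) (⊕-comm y z) ⟩
      x ⊕ (z ⊕ y)   ≡⟨ ⊕-assoc x z y ⟨
      (x ⊕ z) ⊕ y   ∎

module Potential {c ℓ} (R : RealField c ℓ) (N : ℕ) (v : Fin (suc (N + N)) → RealField.Carrier R) where
  open RealField R using (Carrier; 0#; isCommutativeRing; isTotalOrder)
    renaming (_+_ to _⊕_; _-_ to _⊖_; _≤_ to _≼_; _<_ to _≺_)
  open IsCommutativeRing isCommutativeRing using () renaming (+-assoc to ⊕-assoc; +-identityʳ to ⊕-identityʳ)
  open IsTotalOrder isTotalOrder using () renaming (reflexive to ≼-reflexive)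
  open OrderedField R
  open Cyclic (N + N) v renaming (ext to g)
  open Extrema ≼-totalOrder using (argmin; f[argmin]≤v⁺)
  open ≡-Reasoning

  rot : Fin m → Fin m → Carrier
  rot σ = ρ^ (toℕ σ) v

  Φ : ℕ → Carrier
  Φ x = sumTo R N (λ i → g (x + (i + i ∸ 1)))

  Φ-mod : ∀ x y → x % m ≡ y % m → Φ x ≡ Φ y
  Φ-mod x y x≡y = sumTo-cong N λ i →
    ext-mod (x + (i + suc i)) (y + (i + suc i)) (+-cong-mod {x} {y} (i + suc i) m x≡y)

  Φ-periodic : ∀ x → Φ (x + m) ≡ Φ x
  Φ-periodic x = Φ-mod (x + m) x ([m+n]%n≡m%n x m)

  -- Moving two steps on exchanges g(x+1) for g(x+2N+1) = g x.
  Φ-step : ∀ x → Φ (suc (suc x)) ⊕ g (suc x) ≡ Φ x ⊕ g x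
  Φ-step x = begin
    Φ (suc (suc x)) ⊕ g (suc x)
      ≡⟨ cong₂ _⊕_ (sumTo-cong N (λ i → cong g (two-on x i))) (cong g (+-comm 1 x)) ⟩
    sumTo R N (h ∘ suc) ⊕ h 1
      ≡⟨ sumTo-shift N h ⟩
    Φ x ⊕ h (suc N)
      ≡⟨ cong (Φ x ⊕_) (ext-mod (x + (N + suc N)) x (trans (cong (_% m) (wrap x N)) ([m+n]%n≡m%n x m))) ⟩
    Φ x ⊕ g x ∎
    where
    h : ℕ → Carrier
    h i = g (x + (i + i ∸ 1))
    two-on : ∀ x i → suc (suc x) + (i + suc i) ≡ x + (suc i + suc (suc i))
    two-on = solve-∀
    wrap : ∀ x N → x + (N + suc N) ≡ x + suc (N + N)
    wrap = solve-∀

  Φ-advance : ∀ x → Φ x ⊕ (g x ⊖ g (suc x)) ≡ Φ (suc (suc x))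
  Φ-advance x = solve-for (Φ-step x)

  Φ-retreat : ∀ x → Φ (suc (suc x)) ⊕ (g (suc x) ⊖ g x) ≡ Φ x
  Φ-retreat x = solve-for (sym (Φ-step x))

  at-rot : ∀ σ k → k < m → at R (rot σ) (suc k) ≡ g (start σ + k)
  at-rot σ k k<m with k <? m
  ... | yes k<m′ = trans (ρ^-start σ _) (cong (λ i → g (start σ + i)) (toℕ-fromℕ< k<m′))
  ... | no  k≮m  = contradiction k<m k≮m

  inside : ∀ {d} → d < N → (d + d < m) × (suc (d + d) < m) × (suc (suc (d + d)) < m)
  inside d<N = m<n⇒m<1+n (+-mono-< d<N d<N) , m<n⇒m<1+n (double-< d<N) , s≤s (double-< d<N)

  S₁-potential : ∀ σ k → k ≤ N → Φ (start σ) ⊕ S₁ R (rot σ) k ≡ Φ (start σ + (k + k))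
  S₁-potential σ zero    _   = trans (⊕-identityʳ _) (cong Φ (sym (+-identityʳ (start σ))))
  S₁-potential σ (suc k) k<N = begin
    Φ s ⊕ (S₁ R w k ⊕ (at R w (2 * suc k ∸ 1) ⊖ at R w (2 * suc k)))
      ≡⟨ ⊕-assoc _ _ _ ⟨
    (Φ s ⊕ S₁ R w k) ⊕ (at R w (2 * suc k ∸ 1) ⊖ at R w (2 * suc k))
      ≡⟨ cong₂ _⊕_ (S₁-potential σ k (<⇒≤ k<N)) (cong₂ _⊖_ odd-entry even-entry) ⟩
    Φ x ⊕ (g x ⊖ g (suc x))
      ≡⟨ Φ-advance x ⟩
    Φ (suc (suc x))
      ≡⟨ cong Φ (two-more s k) ⟩
    Φ (s + (suc k + suc k)) ∎
    where
    s = start σ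
    w = rot σ
    x = s + (k + k)
    odd-entry : at R w (2 * suc k ∸ 1) ≡ g x
    odd-entry = trans (cong (at R w) (proj₁ (S₁-indices k))) (at-rot σ _ (proj₁ (inside k<N)))
    even-entry : at R w (2 * suc k) ≡ g (suc x)
    even-entry = trans (cong (at R w) (proj₂ (S₁-indices k)))
                   (trans (at-rot σ _ (proj₁ (proj₂ (inside k<N)))) (cong g (+-suc s (k + k))))
    two-more : ∀ s k → suc (suc (s + (k + k))) ≡ s + (suc k + suc k)
    two-more = solve-∀

  S₂-potential : ∀ σ k d → k + d ≡ N → Φ (start σ) ⊕ S₂ R (suc N) (rot σ) k ≡ Φ (start σ + suc (d + d))
  S₂-potential σ zero    d refl = trans (⊕-identityʳ _) (sym (Φ-periodic (start σ)))
  S₂-potential σ (suc k) d k+d≡N = begin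
    Φ s ⊕ (S₂ R (suc N) w k ⊕ (at R w (2 * suc N ∸ (2 * suc k ∸ 1)) ⊖ at R w (2 * suc N ∸ 2 * suc k)))
      ≡⟨ ⊕-assoc _ _ _ ⟨
    (Φ s ⊕ S₂ R (suc N) w k) ⊕ (at R w (2 * suc N ∸ (2 * suc k ∸ 1)) ⊖ at R w (2 * suc N ∸ 2 * suc k))
      ≡⟨ cong₂ _⊕_ (trans (S₂-potential σ k (suc d) (trans (+-suc k d) k+d≡N)) (cong Φ (two-back s d)))
                    (cong₂ _⊖_ upper-entry lower-entry) ⟩
    Φ (suc (suc z)) ⊕ (g (suc z) ⊖ g z)
      ≡⟨ Φ-retreat z ⟩
    Φ z ∎
    where
    s = start σ
    w = rot σ
    z = s + suc (d + d)
    d<N : d < N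
    d<N = ≤-of-sum k (trans (cong suc (+-comm d k)) k+d≡N)
    upper-entry : at R w (2 * suc N ∸ (2 * suc k ∸ 1)) ≡ g (suc z)
    upper-entry = trans (cong (at R w) (proj₁ (S₂-indices k d k+d≡N)))
                    (trans (at-rot σ _ (proj₂ (proj₂ (inside d<N)))) (cong g (+-suc s (suc (d + d)))))
    lower-entry : at R w (2 * suc N ∸ 2 * suc k) ≡ g z
    lower-entry = trans (cong (at R w) (proj₂ (S₂-indices k d k+d≡N)))
                    (at-rot σ _ (proj₁ (proj₂ (inside d<N))))
    two-back : ∀ s d → s + suc (suc d + suc d) ≡ suc (suc (s + suc (d + d)))
    two-back = solve-∀

  MinimalAt : ∀ {r} → (Carrier → Carrier → Set r) → ℕ → Set r
  MinimalAt _∼_ x = ∀ j → 0 < j → j < m → Φ x ∼ Φ (x + j)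

  partial-sums⇒minimal : ∀ {r} (_∼_ : Carrier → Carrier → Set r) →
    (∀ a {t} → 0# ∼ t → a ∼ (a ⊕ t)) → ∀ σ →
    (∀ k → 1 ≤ k → k ≤ N → (0# ∼ S₁ R (rot σ) k) × (0# ∼ S₂ R (suc N) (rot σ) k)) →
    MinimalAt _∼_ (start σ)
  partial-sums⇒minimal _∼_ grow σ sums = every-offset {P = λ j → Φ s ∼ Φ (s + j)} N even odd
    where
    s = start σ
    even : ∀ k → 1 ≤ k → k ≤ N → Φ s ∼ Φ (s + (k + k))
    even k 1≤k k≤N = subst (Φ s ∼_) (S₁-potential σ k k≤N) (grow (Φ s) (proj₁ (sums k 1≤k k≤N)))
    odd : ∀ d → d < N → Φ s ∼ Φ (s + suc (d + d))
    odd d d<N = subst (Φ s ∼_) (S₂-potential σ (N ∸ d) d (m∸n+n≡m (<⇒≤ d<N)))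
                  (grow (Φ s) (proj₂ (sums (N ∸ d) (m<n⇒0<n∸m d<N) (m∸n≤m N d))))

  balanced⇒minimal : ∀ σ → Balanced R (suc N) (rot σ) → MinimalAt _≼_ (start σ)
  balanced⇒minimal = partial-sums⇒minimal _≼_ ≼-+-nonneg

  strictly-balanced⇒strictly-minimal : ∀ σ → StrictlyBalanced R (suc N) (rot σ) → MinimalAt _≺_ (start σ)
  strictly-balanced⇒strictly-minimal = partial-sums⇒minimal _≺_ ≺-+-pos

  minimum⇒balanced : ∀ σ → (∀ y → Φ (start σ) ≼ Φ y) → Balanced R (suc N) (rot σ)
  minimum⇒balanced σ minimum k _ k≤N =
      ≼-+-nonneg⁻¹ (Φ s) (subst (Φ s ≼_) (sym (S₁-potential σ k k≤N)) (minimum (s + (k + k))))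
    , ≼-+-nonneg⁻¹ (Φ s) (subst (Φ s ≼_) (sym (S₂-potential σ k d (m+[n∸m]≡n k≤N))) (minimum (s + suc (d + d))))
    where
    s = start σ
    d = N ∸ k

  Reaches : ℕ → ℕ → Set
  Reaches x y = Σ ℕ (λ j → 0 < j × j < m × (x + j) % m ≡ y % m)

  distinct-starts-reach : ∀ {σ τ} → toℕ τ < toℕ σ →
                          Reaches (start σ) (start τ) × Reaches (start τ) (start σ)
  distinct-starts-reach {σ} τ<σ with gaps τ<σ (toℕ<n σ)
  ... | (j , 0<j , j<m , forward) , (j′ , 0<j′ , j′<m , around) =
        (j , 0<j , j<m , cong (_% m) forward) ,
        (j′ , 0<j′ , j′<m , trans (cong (_% m) around) ([m+n]%n≡m%n (start σ) m))

  clash : ∀ x y → MinimalAt _≺_ x → MinimalAt _≼_ y → Reaches x y × Reaches y x → ⊥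
  clash x y x-strict y-min ((j , 0<j , j<m , x+j≡y) , (j′ , 0<j′ , j′<m , y+j′≡x)) =
    ≺-≼-asym (subst (Φ x ≺_) (Φ-mod (x + j) y x+j≡y) (x-strict j 0<j j<m))
             (subst (Φ y ≼_) (Φ-mod (y + j′) x y+j′≡x) (y-min j′ 0<j′ j′<m))

  minimiser : Fin m
  minimiser = argmin (Φ ∘ start) Fin.zero (allFin m)

  minimiser-global : ∀ y → Φ (start minimiser) ≼ Φ y
  minimiser-global y with start-onto y
  ... | τ , τ≡y = subst (Φ (start minimiser) ≼_) (Φ-mod (start τ) y τ≡y)
    (f[argmin]≤v⁺ {f = Φ ∘ start} Fin.zero (allFin m)
      (inj₂ (Any.map (λ τ≡σ → ≼-reflexive (cong (Φ ∘ start) (sym τ≡σ))) (∈-allFin τ))))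

  existence : Σ (Fin m) (λ σ → Balanced R (suc N) (rot σ))
  existence = minimiser , minimum⇒balanced minimiser minimiser-global

  uniqueness : ∀ σ → StrictlyBalanced R (suc N) (rot σ) → ∀ τ → Balanced R (suc N) (rot τ) → τ ≡ σ
  uniqueness σ strict τ balanced = by-order (<-cmp (toℕ τ) (toℕ σ))
    where
    excluded : Reaches (start σ) (start τ) × Reaches (start τ) (start σ) → ⊥
    excluded = clash (start σ) (start τ)
                 (strictly-balanced⇒strictly-minimal σ strict) (balanced⇒minimal τ balanced)
    by-order : Tri (toℕ τ < toℕ σ) (toℕ τ ≡ toℕ σ) (toℕ σ < toℕ τ) → τ ≡ σ
    by-order (tri≈ _ τ≡σ _) = toℕ-injective τ≡σ
    by-order (tri< τ<σ _ _) = ⊥-elim (excluded (distinct-starts-reach τ<σ))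
    by-order (tri> _ _ σ<τ) = ⊥-elim (excluded (swap (distinct-starts-reach σ<τ)))

-- The statement of the theorem for n, with the vector length m = 2n − 1
-- as a separate parameter (it is suc (N + N) only propositionally).
Claim : ∀ {c ℓ} (R : RealField c ℓ) (n m : ℕ) → Set (c ⊔ ℓ)
Claim R n m =
    ((v : Fin m → RealField.Carrier R) → Nonneg R v →
    Σ (Fin m) (λ σ → Balanced R n (ρ^ (toℕ σ) v)))
    ×
    ((v : Fin m → RealField.Carrier R) → Nonneg R v →
    (σ : Fin m) → StrictlyBalanced R n (ρ^ (toℕ σ) v) →
    (τ : Fin m) → Balanced R n (ρ^ (toℕ τ) v) → τ ≡ σ)

-- Both assertions are those of Potential for m = 2N + 1, transported along
-- 2n ∸ 1 ≡ 2N + 1 where n = N + 1.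
corollary2p9 : ∀ {c ℓ} (R : RealField c ℓ) (n : ℕ) → 1 ≤ n →
    ((v : Fin (2 * n ∸ 1) → RealField.Carrier R) → Nonneg R v →
    Σ (Fin (2 * n ∸ 1)) (λ σ → Balanced R n (ρ^ (toℕ σ) v)))
    ×
    ((v : Fin (2 * n ∸ 1) → RealField.Carrier R) → Nonneg R v →
    (σ : Fin (2 * n ∸ 1)) → StrictlyBalanced R n (ρ^ (toℕ σ) v) →
    (τ : Fin (2 * n ∸ 1)) → Balanced R n (ρ^ (toℕ τ) v) → τ ≡ σ)
corollary2p9 R (suc N) _ = subst (Claim R (suc N)) (sym (proj₁ (S₁-indices N)))
  ((λ v _ → Potential.existence R N v) , (λ v _ → Potential.uniqueness R N v))
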